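{- Let $\Pi$ be a finite set of forbidden patterns all of the form $\langle u,o,h\rangle$ with $u$ linear, let $l\rightarrow r$ be a rewrite rule, $\sigma$ a substitution, $C$ a context (possibly containing the symbols $\mathsf{top}_s$) with hole at position $p$, and let $l' = C[l\sigma]_p$, $r' = C[r\sigma]_p$ be such that the positioned rule $\langle l'\rightarrow r', p\rangle$ is $\Pi$-stable. If $s \rightarrow t$ by one rewrite step with the rule $l'\rightarrow r'$, then $s \rightarrow_{\{l\rightarrow r\},\Pi} t$, i.e. $s \rightarrow_{\Pi} t$ with the rule $l\rightarrow r$.
   Context: Forbidden-pattern rewriting with rules $R$: $s \rightarrow_{R,\Pi} t$ iff $s \xrightarrow{p}_{R} t$ at some non-variable position $p$ of $s$ and there is no $\langle u,o,h\rangle\in\Pi$, context $D$, position $q'$, substitution $\tau$ with $s = D[u\tau]_{q'}$ and $p = q'.o$. A positioned rule $\langle l\rightarrow r,p\rangle$ is $\Pi$-stable if there is no context $C$, substitution $\sigma$, positions $q,q'$, pattern $\langle u,o,h\rangle\in\Pi$ and substitution $\theta$ with $C[l\sigma]_q|_{q'} = u\theta$ and $q.p = q'.o$. For each sort $s$, $\mathsf{top}_s$ is a fresh unary symbol of type $s\rightarrow s$ not occurring in $\Pi$. -}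

module Defs where

open import Data.Nat using (ℕ; zero; suc)
open import Data.List using (List; []; _∷_; _++_; length)
open import Data.List.Membership.Propositional using (_∈_)
open import Data.List.Relation.Unary.All using (All)
open import Data.List.Relation.Unary.Unique.Propositional using (Unique)
open import Data.List.Relation.Binary.Pointwise using (Pointwise)
open import Data.List.Relation.Binary.Subset.Propositional using (_⊆_)
open import Data.Maybe using (Maybe; just; nothing)
open import Data.Sum using (_⊎_; inj₁; inj₂)
open import Data.Product using (Σ; ∃; ∃₂; _×_; _,_)
open import Data.Empty using (⊥)
open import Relation.Nullary using (¬_)
open import Relation.Binary.PropositionalEquality using (_≡_; _≢_)

record Signature : Set₁ where
  field
    Sort     : Set
    Fun      : Set
    Var      : Set
    argSorts : Fun → List Sort
    resSort  : Fun → Sort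
    varSort  : Var → Sort

module Rewriting (S : Signature) where
  open Signature S public

  -- Extended signature: original symbols plus a fresh top_s : s → s for each sort s.
  Sym : Set
  Sym = Fun ⊎ Sort

  top : Sort → Sym
  top = inj₂

  symArgs : Sym → List Sort
  symArgs (inj₁ f) = argSorts f
  symArgs (inj₂ s) = s ∷ []

  symRes : Sym → Sort
  symRes (inj₁ f) = resSort f
  symRes (inj₂ s) = s

  data Term : Set where
    var : Var → Term
    fun : Sym → List Term → Term

  data WS : Term → Sort → Set where
    var : ∀ {x} → WS (var x) (varSort x)
    fun : ∀ {f ts} → Pointwise WS ts (symArgs f) → WS (fun f ts) (symRes f)

  data TopFree : Term → Set where
    var : ∀ {x} → TopFree (var x)
    fun : ∀ {f ts} → All TopFree ts → TopFree (fun (inj₁ f) ts)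

  Subst : Set
  Subst = Var → Term

  WSSubst : Subst → Set
  WSSubst σ = ∀ x → WS (σ x) (varSort x)

  mutual
    _⟨_⟩ : Term → Subst → Term
    var x ⟨ σ ⟩ = σ x
    fun f ts ⟨ σ ⟩ = fun f (ts ⟨ σ ⟩*)

    _⟨_⟩* : List Term → Subst → List Term
    [] ⟨ σ ⟩* = []
    (t ∷ ts) ⟨ σ ⟩* = (t ⟨ σ ⟩) ∷ (ts ⟨ σ ⟩*)

  mutual
    vars : Term → List Var
    vars (var x) = x ∷ []
    vars (fun f ts) = vars* ts

    vars* : List Term → List Var
    vars* [] = []
    vars* (t ∷ ts) = vars t ++ vars* ts

  Linear : Term → Set
  Linear t = Unique (vars t)

  -- positions: sequences of argument indices (0-based)
  Pos : Set
  Pos = List ℕ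

  mutual
    _∣_ : Term → Pos → Maybe Term
    t ∣ [] = just t
    var x ∣ (i ∷ p) = nothing
    fun f ts ∣ (i ∷ p) = nth ts i p

    nth : List Term → ℕ → Pos → Maybe Term
    nth [] i p = nothing
    nth (t ∷ ts) zero p = t ∣ p
    nth (t ∷ ts) (suc i) p = nth ts i p

  data Ctx : Set where
    □   : Ctx
    fun : Sym → List Term → Ctx → List Term → Ctx

  _[_] : Ctx → Term → Term
  □ [ t ] = t
  fun f ls C rs [ t ] = fun f (ls ++ (C [ t ]) ∷ rs)

  holePos : Ctx → Pos
  holePos □ = []
  holePos (fun f ls C rs) = length ls ∷ holePos C

  -- WSC C h k : C is a well-sorted context with hole of sort h and result sort k
  data WSC : Ctx → Sort → Sort → Set where
    □   : ∀ {h} → WSC □ h h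
    fun : ∀ {f ls C rs h s ss₁ ss₂} →
          Pointwise WS ls ss₁ → WSC C h s → Pointwise WS rs ss₂ →
          symArgs f ≡ ss₁ ++ s ∷ ss₂ → WSC (fun f ls C rs) h (symRes f)

  record Rule : Set where
    field
      lhs        : Term
      rhs        : Term
      sort       : Sort
      lhs-ws     : WS lhs sort
      rhs-ws     : WS rhs sort
      lhs-nonvar : ∀ x → lhs ≢ var x
      vars-rhs   : vars rhs ⊆ vars lhs
  open Rule public

  data Mode : Set where
    here above below : Mode

  record Pattern : Set where
    field
      pat       : Term
      ppos      : Pos
      mode      : Mode
      pat-ws    : ∃ λ s → WS pat s
      ppos-valid : ∃ λ t → pat ∣ ppos ≡ just t
  open Pattern public

  StepAt : Term → Term → Sort → Pos → Term → Term → Set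
  StepAt l r h p s t =
    Σ Ctx λ D → Σ Subst λ τ →
      holePos D ≡ p × WSSubst τ × (∃ λ k → WSC D h k) ×
      s ≡ D [ l ⟨ τ ⟩ ] × t ≡ D [ r ⟨ τ ⟩ ]

  Step : Term → Term → Sort → Term → Term → Set
  Step l r h s t = ∃ λ p → StepAt l r h p s t

  NonVarPos : Term → Pos → Set
  NonVarPos s p = ∃₂ λ f ts → s ∣ p ≡ just (fun f ts)

  Forbidden : List Pattern → Term → Pos → Set
  Forbidden Π s p =
    Σ Pattern λ π → π ∈ Π × Σ Ctx λ D → Σ Subst λ θ →
      s ≡ D [ pat π ⟨ θ ⟩ ] × p ≡ holePos D ++ ppos π

  ΠStep : List Pattern → Rule → Term → Term → Set
  ΠStep Π ρ s t =
    ∃ λ p → NonVarPos s p × StepAt (lhs ρ) (rhs ρ) (sort ρ) p s t × ¬ Forbidden Π s p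

  Stable : List Pattern → Term → Sort → Pos → Set
  Stable Π l h p =
    ∀ (C : Ctx) (σ : Subst) (k : Sort) (q q' : Pos) (π : Pattern) (θ : Subst) →
      WSC C h k → WSSubst σ → holePos C ≡ q → π ∈ Π →
      (C [ l ⟨ σ ⟩ ]) ∣ q' ≡ just (pat π ⟨ θ ⟩) → q ++ p ≡ q' ++ ppos π → ⊥

-- A step with the instance l' = C[lσ] at position q is a step with l at q.p, since
-- D[C[lσ]τ] = (D ∘ Cτ)[l(στ)].  The position q.p is not forbidden: a forbidding
-- pattern instance would be exactly what Π-stability of ⟨l' → r', p⟩ excludes,
-- taking the context D and the substitution τ of the step.
module Submission where

open import Defs
open import Data.Nat using (suc)
open import Data.List using (List; []; _∷_; _++_; length)
open import Data.List.Properties using (++-identityʳ)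
open import Data.List.Relation.Unary.All using (All)
open import Data.List.Relation.Binary.Pointwise using (Pointwise; []; _∷_)
open import Data.Maybe using (just)
open import Data.Product using (_,_)
open import Data.Empty using (⊥-elim)
open import Relation.Nullary using (¬_)
open import Relation.Binary.PropositionalEquality
  using (_≡_; _≢_; refl; sym; trans; cong; cong₂; subst; module ≡-Reasoning)

module Properties (S : Signature) where
  open Rewriting S

  _∘ˢ_ : Subst → Subst → Subst
  (σ ∘ˢ τ) x = σ x ⟨ τ ⟩

  mutual
    ⟨⟩-∘ˢ : ∀ t σ τ → (t ⟨ σ ⟩) ⟨ τ ⟩ ≡ t ⟨ σ ∘ˢ τ ⟩
    ⟨⟩-∘ˢ (var x) σ τ = refl
    ⟨⟩-∘ˢ (fun f ts) σ τ = cong (fun f) (⟨⟩*-∘ˢ ts σ τ)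

    ⟨⟩*-∘ˢ : ∀ ts σ τ → (ts ⟨ σ ⟩*) ⟨ τ ⟩* ≡ ts ⟨ σ ∘ˢ τ ⟩*
    ⟨⟩*-∘ˢ [] σ τ = refl
    ⟨⟩*-∘ˢ (t ∷ ts) σ τ = cong₂ _∷_ (⟨⟩-∘ˢ t σ τ) (⟨⟩*-∘ˢ ts σ τ)

  mutual
    WS-⟨⟩ : ∀ {t s τ} → WSSubst τ → WS t s → WS (t ⟨ τ ⟩) s
    WS-⟨⟩ wτ (var {x}) = wτ x
    WS-⟨⟩ wτ (fun wts) = fun (WS-⟨⟩* wτ wts)

    WS-⟨⟩* : ∀ {ts ss τ} → WSSubst τ → Pointwise WS ts ss → Pointwise WS (ts ⟨ τ ⟩*) ss
    WS-⟨⟩* wτ [] = []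
    WS-⟨⟩* wτ (wt ∷ wts) = WS-⟨⟩ wτ wt ∷ WS-⟨⟩* wτ wts

  WSSubst-∘ˢ : ∀ {σ τ} → WSSubst σ → WSSubst τ → WSSubst (σ ∘ˢ τ)
  WSSubst-∘ˢ wσ wτ x = WS-⟨⟩ wτ (wσ x)

  ⟨⟩*-++ : ∀ ls t rs τ → (ls ++ t ∷ rs) ⟨ τ ⟩* ≡ ls ⟨ τ ⟩* ++ t ⟨ τ ⟩ ∷ rs ⟨ τ ⟩*
  ⟨⟩*-++ [] t rs τ = refl
  ⟨⟩*-++ (l ∷ ls) t rs τ = cong (l ⟨ τ ⟩ ∷_) (⟨⟩*-++ ls t rs τ)

  length-⟨⟩* : ∀ ts τ → length (ts ⟨ τ ⟩*) ≡ length ts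
  length-⟨⟩* [] τ = refl
  length-⟨⟩* (t ∷ ts) τ = cong suc (length-⟨⟩* ts τ)

  _⟨_⟩ᶜ : Ctx → Subst → Ctx
  □ ⟨ τ ⟩ᶜ = □
  fun f ls C rs ⟨ τ ⟩ᶜ = fun f (ls ⟨ τ ⟩*) (C ⟨ τ ⟩ᶜ) (rs ⟨ τ ⟩*)

  []-⟨⟩ : ∀ C t τ → (C [ t ]) ⟨ τ ⟩ ≡ (C ⟨ τ ⟩ᶜ) [ t ⟨ τ ⟩ ]
  []-⟨⟩ □ t τ = refl
  []-⟨⟩ (fun f ls C rs) t τ = cong (fun f) (begin
      (ls ++ C [ t ] ∷ rs) ⟨ τ ⟩*              ≡⟨ ⟨⟩*-++ ls (C [ t ]) rs τ ⟩
      ls ⟨ τ ⟩* ++ (C [ t ]) ⟨ τ ⟩ ∷ rs ⟨ τ ⟩*   ≡⟨ cong (λ u → ls ⟨ τ ⟩* ++ u ∷ rs ⟨ τ ⟩*) ([]-⟨⟩ C t τ) ⟩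
      ls ⟨ τ ⟩* ++ (C ⟨ τ ⟩ᶜ) [ t ⟨ τ ⟩ ] ∷ rs ⟨ τ ⟩* ∎)
    where open ≡-Reasoning

  holePos-⟨⟩ᶜ : ∀ C τ → holePos (C ⟨ τ ⟩ᶜ) ≡ holePos C
  holePos-⟨⟩ᶜ □ τ = refl
  holePos-⟨⟩ᶜ (fun f ls C rs) τ = cong₂ _∷_ (length-⟨⟩* ls τ) (holePos-⟨⟩ᶜ C τ)

  WSC-⟨⟩ᶜ : ∀ {C h k τ} → WSSubst τ → WSC C h k → WSC (C ⟨ τ ⟩ᶜ) h k
  WSC-⟨⟩ᶜ wτ □ = □
  WSC-⟨⟩ᶜ wτ (fun wls wC wrs eq) = fun (WS-⟨⟩* wτ wls) (WSC-⟨⟩ᶜ wτ wC) (WS-⟨⟩* wτ wrs) eq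

  _∘ᶜ_ : Ctx → Ctx → Ctx
  □ ∘ᶜ E = E
  fun f ls C rs ∘ᶜ E = fun f ls (C ∘ᶜ E) rs

  []-∘ᶜ : ∀ D E t → (D ∘ᶜ E) [ t ] ≡ D [ E [ t ] ]
  []-∘ᶜ □ E t = refl
  []-∘ᶜ (fun f ls C rs) E t = cong (λ u → fun f (ls ++ u ∷ rs)) ([]-∘ᶜ C E t)

  holePos-∘ᶜ : ∀ D E → holePos (D ∘ᶜ E) ≡ holePos D ++ holePos E
  holePos-∘ᶜ □ E = refl
  holePos-∘ᶜ (fun f ls C rs) E = cong (length ls ∷_) (holePos-∘ᶜ C E)

  WSC-∘ᶜ : ∀ {D E a b c} → WSC D b c → WSC E a b → WSC (D ∘ᶜ E) a c
  WSC-∘ᶜ □ wE = wE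
  WSC-∘ᶜ (fun wls wD wrs eq) wE = fun wls (WSC-∘ᶜ wD wE) wrs eq

  nth-length : ∀ ls t rs q → nth (ls ++ t ∷ rs) (length ls) q ≡ t ∣ q
  nth-length [] t rs q = refl
  nth-length (l ∷ ls) t rs q = nth-length ls t rs q

  []-∣-holePos-++ : ∀ D t q → (D [ t ]) ∣ (holePos D ++ q) ≡ t ∣ q
  []-∣-holePos-++ □ t q = refl
  []-∣-holePos-++ (fun f ls C rs) t q =
    trans (nth-length ls (C [ t ]) rs (holePos C ++ q)) ([]-∣-holePos-++ C t q)

  []-∣-holePos : ∀ D t → (D [ t ]) ∣ holePos D ≡ just t
  []-∣-holePos D t =
    subst (λ q → (D [ t ]) ∣ q ≡ just t) (++-identityʳ (holePos D)) ([]-∣-holePos-++ D t [])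

  NonVarPos-[] : ∀ D {l} τ → (∀ x → l ≢ var x) → NonVarPos (D [ l ⟨ τ ⟩ ]) (holePos D)
  NonVarPos-[] D {var x} τ l≢var = ⊥-elim (l≢var x refl)
  NonVarPos-[] D {fun f ts} τ l≢var = f , ts ⟨ τ ⟩* , []-∣-holePos D _

  StepAt-instance : ∀ l r {h k C σ q s t} → WSC C h k → WSSubst σ →
    StepAt (C [ l ⟨ σ ⟩ ]) (C [ r ⟨ σ ⟩ ]) k q s t → StepAt l r h (q ++ holePos C) s t
  StepAt-instance l r {C = C} {σ} wC wσ (D , τ , refl , wτ , (k′ , wD) , refl , refl) =
    D ∘ᶜ (C ⟨ τ ⟩ᶜ) , σ ∘ˢ τ ,
    trans (holePos-∘ᶜ D (C ⟨ τ ⟩ᶜ)) (cong (holePos D ++_) (holePos-⟨⟩ᶜ C τ)) ,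
    WSSubst-∘ˢ wσ wτ , (k′ , WSC-∘ᶜ wD (WSC-⟨⟩ᶜ wτ wC)) , plug-instance l , plug-instance r
    where
      plug-instance : ∀ u → D [ (C [ u ⟨ σ ⟩ ]) ⟨ τ ⟩ ] ≡ (D ∘ᶜ (C ⟨ τ ⟩ᶜ)) [ u ⟨ σ ∘ˢ τ ⟩ ]
      plug-instance u = begin
        D [ (C [ u ⟨ σ ⟩ ]) ⟨ τ ⟩ ]         ≡⟨ cong (D [_]) ([]-⟨⟩ C (u ⟨ σ ⟩) τ) ⟩
        D [ (C ⟨ τ ⟩ᶜ) [ (u ⟨ σ ⟩) ⟨ τ ⟩ ] ] ≡⟨ cong (λ v → D [ (C ⟨ τ ⟩ᶜ) [ v ] ]) (⟨⟩-∘ˢ u σ τ) ⟩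
        D [ (C ⟨ τ ⟩ᶜ) [ u ⟨ σ ∘ˢ τ ⟩ ] ]   ≡⟨ sym ([]-∘ᶜ D (C ⟨ τ ⟩ᶜ) (u ⟨ σ ∘ˢ τ ⟩)) ⟩
        (D ∘ᶜ (C ⟨ τ ⟩ᶜ)) [ u ⟨ σ ∘ˢ τ ⟩ ] ∎
        where open ≡-Reasoning

  StepAt⇒NonVarPos : ∀ {l} r {h p s t} → (∀ x → l ≢ var x) → StepAt l r h p s t → NonVarPos s p
  StepAt⇒NonVarPos r l≢var (D , τ , refl , _ , _ , refl , _) = NonVarPos-[] D τ l≢var

  Stable⇒¬Forbidden : ∀ {Π} l r {h p q s t} → Stable Π l h p → StepAt l r h q s t →
    ¬ Forbidden Π s (q ++ p)
  Stable⇒¬Forbidden l r stable (D , τ , refl , wτ , (_ , wD) , refl , _) (π , π∈Π , F , θ , s≡F[πθ] , q++p≡pos) =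
    stable D τ _ _ (holePos F) π θ wD wτ refl π∈Π
      (trans (cong (_∣ holePos F) s≡F[πθ]) ([]-∣-holePos F _)) q++p≡pos

lemma21 : (S : Signature) → let open Rewriting S in
    (Π : List Pattern) →
    All (λ π → Linear (pat π)) Π → All (λ π → TopFree (pat π)) Π →
    (ρ : Rule) → TopFree (lhs ρ) → TopFree (rhs ρ) →
    (σ : Subst) → WSSubst σ →
    (C : Ctx) (k : Sort) → WSC C (sort ρ) k →
    (p : Pos) → holePos C ≡ p →
    Stable Π (C [ lhs ρ ⟨ σ ⟩ ]) k p →
    (s t : Term) → Step (C [ lhs ρ ⟨ σ ⟩ ]) (C [ rhs ρ ⟨ σ ⟩ ]) k s t →
    ΠStep Π ρ s t
lemma21 S Π _ _ ρ _ _ σ wσ C k wC p refl stable s t (q , step) =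
  q ++ p , StepAt⇒NonVarPos (rhs ρ) (lhs-nonvar ρ) stepρ , stepρ ,
  Stable⇒¬Forbidden (C [ lhs ρ ⟨ σ ⟩ ]) (C [ rhs ρ ⟨ σ ⟩ ]) stable step
  where
    open Rewriting S
    open Properties S
    stepρ : StepAt (lhs ρ) (rhs ρ) (sort ρ) (q ++ p) s t
    stepρ = StepAt-instance (lhs ρ) (rhs ρ) wC wσ step
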